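{- Let $t$ be the Thue–Morse word, the fixed point starting with $a$ of the morphism $a\mapsto abba$, $b\mapsto baab$. Let $t(i..j]=t[i+1]\cdots t[j]$ ($0\le i<j$) be an occurrence of a nonempty palindrome in $t$ whose length $j-i$ is neither $1$ nor $3$. Then there exists $m\in\{0,1,2,3\}$ such that $i\equiv m \pmod 4$ and $j\equiv 4-m\pmod 4$; equivalently, $i+j\equiv 0\pmod 4$.
   Context: For a word $w=w[1]w[2]\cdots$, $w(i..j]$ denotes the factor $w[i+1]\cdots w[j]$. An occurrence $t(i..j]$ is said to be of type $(i',j')$ where $i'$, $j'$ are the residues of $i$, $j$ modulo $4$. A palindrome is a word equal to its reversal. -}

module Defs where

open import Data.Nat using (ℕ; zero; suc; _+_; _∸_; _<_)
open import Data.List using (List; []; _∷_; _++_; concatMap; lookup; length)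
open import Data.Maybe using (Maybe; just; nothing)
open import Relation.Binary.PropositionalEquality using (_≡_)

data Letter : Set where
  a b : Letter

μ : Letter → List Letter
μ a = a ∷ b ∷ b ∷ a ∷ []
μ b = b ∷ a ∷ a ∷ b ∷ []

μ* : List Letter → List Letter
μ* = concatMap μ

μ^ : ℕ → List Letter
μ^ zero = a ∷ []
μ^ (suc k) = μ* (μ^ k)

nth : List Letter → ℕ → Maybe Letter
nth [] _ = nothing
nth (x ∷ xs) zero = just x
nth (x ∷ xs) (suc n) = nth xs n

-- The Thue–Morse word t (fixed point of μ starting with a), 1-indexed as in the paper:
-- t[k] for k ≥ 1 is the k-th letter of μ^k(a) (which has length 4^k ≥ k and is a
-- prefix of the fixed point).  As a Maybe to avoid a length proof; t[k] is always
-- 'just' for k ≥ 1.  t[0] is not used.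
t : ℕ → Maybe Letter
t k = nth (μ^ k) (k ∸ 1)

IsPalOcc : ℕ → ℕ → Set
IsPalOcc i j = ∀ k → k < j ∸ i → t (i + 1 + k) ≡ t (j ∸ k)

module Submission where

-- In t = μ(t) every position n = r + 4q lies in the block μ(t[q]) = l l̄ l̄ l, where l = t[q].
-- Inside a block the letters at offsets 0,1 and at offsets 2,3 differ, so two equal adjacent
-- letters can only sit at offsets 1,2 or 3,0, i.e. the left one is at an odd position.  The
-- middle of an even palindrome is such a pair, which forces i + j ≡ 0 (mod 4).  An odd
-- palindrome of length at least 5 has a palindrome of length 5 in its middle, and checking
-- the four offsets of its first letter shows that t has no such factor.

open import Defs
open import Data.Nat using (ℕ; zero; suc; _+_; _*_; _∸_; _<_; _≤_; _%_; _/_; z≤n; s≤s; z<s; s<s; NonZero; >-nonZero)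
open import Data.Nat.Properties
open import Data.Nat.DivMod using (m%n<n; m%n%n≡m%n; %-distribˡ-+; [m+kn]%n≡m%n; m≡m%n+[m/n]*n)
open import Data.Nat.Divisibility using (_∣_; divides; *-monoˡ-∣; n∣m⇒m%n≡0)
open import Data.Nat.Tactic.RingSolver using (solve)
open import Data.List using ([]; _∷_; _++_; length; lookup)
open import Data.List.Properties using (concatMap-++)
open import Data.Maybe using (just; _>>=_)
open import Data.Maybe.Properties using (just-injective)
open import Data.Fin using (fromℕ<)
open import Data.Product using (∃; _×_; _,_)
open import Data.Sum using (inj₁; inj₂)
open import Data.Empty using (⊥; ⊥-elim)
open import Relation.Binary.PropositionalEquality

complement : Letter → Letter
complement a = b
complement b = a

≢-complement : ∀ l → l ≢ complement l
≢-complement a ()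
≢-complement b ()

μ-shape : ∀ l → μ l ≡ l ∷ complement l ∷ complement l ∷ l ∷ []
μ-shape a = refl
μ-shape b = refl

nth-++ˡ : ∀ w v n → n < length w → nth (w ++ v) n ≡ nth w n
nth-++ˡ (x ∷ w) v zero    _        = refl
nth-++ˡ (x ∷ w) v (suc n) (s<s n<) = nth-++ˡ w v n n<

nth-lookup : ∀ w n (n< : n < length w) → nth w n ≡ just (lookup w (fromℕ< n<))
nth-lookup (x ∷ w) zero    _        = refl
nth-lookup (x ∷ w) (suc n) (s<s n<) = nth-lookup w n n<

nth-μ* : ∀ w q r → r < 4 → nth (μ* w) (q * 4 + r) ≡ (nth w q >>= λ l → nth (μ l) r)
nth-μ* []      q       r r<4 = refl
nth-μ* (a ∷ w) zero    r r<4 = nth-++ˡ (μ a) (μ* w) r r<4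
nth-μ* (b ∷ w) zero    r r<4 = nth-++ˡ (μ b) (μ* w) r r<4
nth-μ* (a ∷ w) (suc q) r r<4 = nth-μ* w q r r<4
nth-μ* (b ∷ w) (suc q) r r<4 = nth-μ* w q r r<4

length-μ* : ∀ w → length (μ* w) ≡ length w * 4
length-μ* []      = refl
length-μ* (a ∷ w) = cong (4 +_) (length-μ* w)
length-μ* (b ∷ w) = cong (4 +_) (length-μ* w)

μ^-suc-prefix : ∀ k → ∃ λ v → μ^ (suc k) ≡ μ^ k ++ v
μ^-suc-prefix zero = b ∷ b ∷ a ∷ [] , refl
μ^-suc-prefix (suc k) with μ^-suc-prefix k
... | v , eq = μ* v , trans (cong μ* eq) (concatMap-++ μ (μ^ k) v)

<length-μ^ : ∀ k → k < length (μ^ k)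
<length-μ^ zero    = z<s
<length-μ^ (suc k) = begin-strict
  suc k                    ≤⟨ k<L ⟩
  L                        <⟨ m<m*n L 4 {{>-nonZero (≤-<-trans z≤n k<L)}} (s<s z<s) ⟩
  L * 4                    ≡⟨ length-μ* (μ^ k) ⟨
  length (μ^ (suc k))      ∎
  where
  open ≤-Reasoning
  L = length (μ^ k)
  k<L = <length-μ^ k

nth-μ^-suc : ∀ {k n} → n < length (μ^ k) → nth (μ^ (suc k)) n ≡ nth (μ^ k) n
nth-μ^-suc {k} {n} n< with μ^-suc-prefix k
... | v , eq = trans (cong (λ w → nth w n) eq) (nth-++ˡ (μ^ k) v n n<)

-- The letter t[n + 1], i.e. the Thue–Morse word indexed from 0.
letter : ℕ → Letter
letter n = lookup (μ^ n) (fromℕ< (<length-μ^ n))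

nth-μ^ : ∀ {n k} → n ≤ k → nth (μ^ k) n ≡ just (letter n)
nth-μ^ {n} n≤k with m≤n⇒m<n∨m≡n n≤k
... | inj₂ refl = nth-lookup (μ^ n) n (<length-μ^ n)
nth-μ^ {n} {suc k} _ | inj₁ (s≤s n≤k) =
  trans (nth-μ^-suc {k} (≤-<-trans n≤k (<length-μ^ k))) (nth-μ^ n≤k)

t-letter : ∀ n → t (suc n) ≡ just (letter n)
t-letter n = nth-μ^ (n≤1+n n)

letter-μ : ∀ q r → r < 4 → just (letter (r + q * 4)) ≡ nth (μ (letter q)) r
letter-μ q r r<4 = begin
  just (letter n)                         ≡⟨ nth-μ^ (n≤1+n n) ⟨
  nth (μ* (μ^ n)) n                       ≡⟨ cong (nth (μ* (μ^ n))) (+-comm r (q * 4)) ⟩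
  nth (μ* (μ^ n)) (q * 4 + r)             ≡⟨ nth-μ* (μ^ n) q r r<4 ⟩
  (nth (μ^ n) q >>= λ l → nth (μ l) r)    ≡⟨ cong (_>>= λ l → nth (μ l) r) (nth-μ^ q≤n) ⟩
  nth (μ (letter q)) r                    ∎
  where
  open ≡-Reasoning
  n = r + q * 4
  q≤n = ≤-trans (m≤m*n q 4) (m≤n+m (q * 4) r)

letter-block : ∀ q r → r < 4 →
  just (letter (r + q * 4)) ≡ nth (letter q ∷ complement (letter q) ∷ complement (letter q) ∷ letter q ∷ []) r
letter-block q r r<4 = trans (letter-μ q r r<4) (cong (λ w → nth w r) (μ-shape (letter q)))

letter-q*4 : ∀ q → letter (q * 4) ≡ letter q
letter-q*4 q = just-injective (letter-block q 0 z<s)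

letter-1+q*4 : ∀ q → letter (1 + q * 4) ≡ complement (letter q)
letter-1+q*4 q = just-injective (letter-block q 1 (s<s z<s))

letter-2+q*4 : ∀ q → letter (2 + q * 4) ≡ complement (letter q)
letter-2+q*4 q = just-injective (letter-block q 2 (s<s (s<s z<s)))

letter-3+q*4 : ∀ q → letter (3 + q * 4) ≡ letter q
letter-3+q*4 q = just-injective (letter-block q 3 (s<s (s<s (s<s z<s))))

data Mod4 : ℕ → Set where
  rem0 : ∀ q → Mod4 (q * 4)
  rem1 : ∀ q → Mod4 (1 + q * 4)
  rem2 : ∀ q → Mod4 (2 + q * 4)
  rem3 : ∀ q → Mod4 (3 + q * 4)

mod4 : ∀ n → Mod4 n
mod4 0 = rem0 0
mod4 1 = rem1 0
mod4 2 = rem2 0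
mod4 3 = rem3 0
mod4 (suc (suc (suc (suc n)))) with mod4 n
... | rem0 q = rem0 (suc q)
... | rem1 q = rem1 (suc q)
... | rem2 q = rem2 (suc q)
... | rem3 q = rem3 (suc q)

equal-neighbours⇒2∣suc : ∀ c → letter c ≡ letter (suc c) → 2 ∣ suc c
equal-neighbours⇒2∣suc c with mod4 c
... | rem0 q rewrite letter-q*4 q | letter-1+q*4 q = λ eq → ⊥-elim (≢-complement (letter q) eq)
... | rem1 q = λ _ → divides (1 + q * 2) (solve (q ∷ []))
... | rem2 q rewrite letter-2+q*4 q | letter-3+q*4 q = λ eq → ⊥-elim (≢-complement (letter q) (sym eq))
... | rem3 q = λ _ → divides (2 + q * 2) (solve (q ∷ []))

-- The window meets only the blocks q and suc q, and suc q * 4 reduces to 4 + q * 4.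
no-length-5-palindrome : ∀ p → letter p ≡ letter (4 + p) → letter (1 + p) ≡ letter (3 + p) → ⊥
no-length-5-palindrome p with mod4 p
... | rem0 q rewrite letter-1+q*4 q | letter-3+q*4 q =
  λ _ e₂ → ≢-complement (letter q) (sym e₂)
... | rem1 q rewrite letter-1+q*4 q | letter-2+q*4 q | letter-q*4 (suc q) | letter-1+q*4 (suc q) =
  λ e₁ e₂ → ≢-complement (letter (suc q)) (trans (sym e₂) e₁)
... | rem2 q rewrite letter-2+q*4 q | letter-3+q*4 q | letter-2+q*4 (suc q) | letter-1+q*4 (suc q) =
  λ e₁ e₂ → ≢-complement (letter q) (trans e₂ (sym e₁))
... | rem3 q rewrite letter-q*4 (suc q) | letter-2+q*4 (suc q) =
  λ _ e₂ → ≢-complement (letter (suc q)) e₂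

palindrome-mirror : ∀ {i j} k d → j ≡ i + suc (k + d) → IsPalOcc i j → letter (k + i) ≡ letter (d + i)
palindrome-mirror {i} k d refl pal = just-injective (begin
  just (letter (k + i))        ≡⟨ t-letter (k + i) ⟨
  t (suc (k + i))              ≡⟨ cong t 1+k+i≡i+1+k ⟩
  t (i + 1 + k)                ≡⟨ pal k k<j∸i ⟩
  t (i + suc (k + d) ∸ k)      ≡⟨ cong t j∸k ⟩
  t (suc (d + i))              ≡⟨ t-letter (d + i) ⟩
  just (letter (d + i))        ∎)
  where
  open ≡-Reasoning
  1+k+i≡i+1+k : suc (k + i) ≡ i + 1 + k
  1+k+i≡i+1+k = solve (i ∷ k ∷ [])
  k<j∸i : k < i + suc (k + d) ∸ i
  k<j∸i = subst (k <_) (sym (m+n∸m≡n i (suc (k + d)))) (s≤s (m≤m+n k d))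
  j∸k : i + suc (k + d) ∸ k ≡ suc (d + i)
  j∸k = begin
    i + suc (k + d) ∸ k        ≡⟨ cong (_∸ k) (solve (i ∷ k ∷ d ∷ [])) ⟩
    k + suc (d + i) ∸ k        ≡⟨ m+n∸m≡n k (suc (d + i)) ⟩
    suc (d + i)                ∎

even-palindrome⇒4∣i+j : ∀ {i j} h → j ≡ i + (suc h + suc h) → IsPalOcc i j → 4 ∣ i + j
even-palindrome⇒4∣i+j {i} {j} h j≡ pal =
  subst (4 ∣_) (sym i+j≡) (*-monoˡ-∣ 2 (equal-neighbours⇒2∣suc (h + i) (palindrome-mirror h (suc h) j≡ pal)))
  where
  i+j≡ : i + j ≡ suc (h + i) * 2
  i+j≡ = trans (cong (i +_) j≡) (solve (i ∷ h ∷ []))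

¬odd-palindrome : ∀ {i j} h → j ≡ i + (5 + (h + h)) → IsPalOcc i j → ⊥
¬odd-palindrome {i} h j≡ pal =
  no-length-5-palindrome (h + i)
    (palindrome-mirror h (4 + h) (trans j≡ (cong (i +_) L≡₁)) pal)
    (palindrome-mirror (1 + h) (3 + h) (trans j≡ (cong (i +_) L≡₂)) pal)
  where
  L≡₁ : 5 + (h + h) ≡ suc (h + (4 + h))
  L≡₁ = solve (h ∷ [])
  L≡₂ : 5 + (h + h) ≡ suc (suc h + (3 + h))
  L≡₂ = solve (h ∷ [])

data Parity : ℕ → Set where
  even : ∀ h → Parity (h + h)
  odd  : ∀ h → Parity (suc (h + h))

parity : ∀ n → Parity n
parity zero = even zero
parity (suc n) with parity n
... | even h = odd h
... | odd h  = subst Parity (cong suc (+-suc h h)) (even (suc h))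

palindrome⇒4∣i+j : ∀ {i j L} → Parity L → j ≡ i + L → IsPalOcc i j → 0 < L → L ≢ 1 → L ≢ 3 → 4 ∣ i + j
palindrome⇒4∣i+j (even zero)      _  _   ()
palindrome⇒4∣i+j (even (suc h))   j≡ pal _ _  _  = even-palindrome⇒4∣i+j h j≡ pal
palindrome⇒4∣i+j (odd zero)       _  _   _ ≢1 _  = ⊥-elim (≢1 refl)
palindrome⇒4∣i+j (odd (suc zero)) _  _   _ _  ≢3 = ⊥-elim (≢3 refl)
palindrome⇒4∣i+j {i} (odd (suc (suc h))) j≡ pal _ _ _ =
  ⊥-elim (¬odd-palindrome h (trans j≡ (cong (i +_) L≡)) pal)
  where
  L≡ : suc (suc (suc h) + suc (suc h)) ≡ 5 + (h + h)
  L≡ = solve (h ∷ [])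

[m+n]%d≡0⇒n%d≡[d∸m%d]%d : ∀ m n d .{{_ : NonZero d}} → (m + n) % d ≡ 0 → n % d ≡ (d ∸ m % d) % d
[m+n]%d≡0⇒n%d≡[d∸m%d]%d m n d m+n%d≡0 = begin
  n % d                                  ≡⟨ [m+kn]%n≡m%n n (suc q) d ⟨
  (n + suc q * d) % d                    ≡⟨ cong (_% d) n+[1+q]d≡m+n+e ⟩
  (m + n + e) % d                        ≡⟨ %-distribˡ-+ (m + n) e d ⟩
  ((m + n) % d + e % d) % d              ≡⟨ cong (λ x → (x + e % d) % d) m+n%d≡0 ⟩
  e % d % d                              ≡⟨ m%n%n≡m%n e d ⟩
  e % d                                  ∎
  where
  open ≡-Reasoning
  r = m % d
  q = m / d
  e = d ∸ r
  n+[1+q]d≡m+n+e : n + suc q * d ≡ m + n + e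
  n+[1+q]d≡m+n+e = begin
    n + (d + q * d)                ≡⟨ cong (λ x → n + (x + q * d)) (m+[n∸m]≡n (<⇒≤ (m%n<n m d))) ⟨
    n + ((r + e) + q * d)          ≡⟨ +-*-rearrange n r e q d ⟩
    r + q * d + n + e              ≡⟨ cong (λ x → x + n + e) (m≡m%n+[m/n]*n m d) ⟨
    m + n + e                      ∎
    where
    +-*-rearrange : ∀ w x y z u → w + ((x + y) + z * u) ≡ x + z * u + w + y
    +-*-rearrange w x y z u = solve (w ∷ x ∷ y ∷ z ∷ u ∷ [])

proposition5 : (i j : ℕ) → i < j → IsPalOcc i j → j ∸ i ≢ 1 → j ∸ i ≢ 3 →
    ∃ λ m → m < 4 × i % 4 ≡ m % 4 × j % 4 ≡ (4 ∸ m) % 4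
proposition5 i j i<j pal ≢1 ≢3 =
  i % 4 , m%n<n i 4 , sym (m%n%n≡m%n i 4) , [m+n]%d≡0⇒n%d≡[d∸m%d]%d i j 4 (n∣m⇒m%n≡0 (i + j) 4 4∣i+j)
  where
  4∣i+j : 4 ∣ i + j
  4∣i+j = palindrome⇒4∣i+j (parity (j ∸ i)) (sym (m+[n∸m]≡n (<⇒≤ i<j))) pal (m<n⇒0<n∸m i<j) ≢1 ≢3
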